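{- Let $G$ be a distance-regular graph with valency $k\ge3$ and diameter $D\ge3$. Then $h_G\le\frac{k-2}{k}$.
   Context: A connected graph of diameter $D$ is distance-regular if there are integers $b_i,c_i$ such that for all vertices $x,y$ at distance $i$, $y$ has exactly $c_i$ neighbours at distance $i-1$ from $x$ and $b_i$ neighbours at distance $i+1$ from $x$. For $A,B\subseteq V(G)$, $E[A,B]$ is the number of ordered pairs $(x,y)$ with $x\in A$, $y\in B$, $x\sim y$; $\mathrm{vol}(S)=\sum_{x\in S}\deg(x)$; $S^c=V(G)\setminus S$. The Cheeger constant is $h_G=\min\{E[S,S^c]/\mathrm{vol}(S):\emptyset\ne S\subseteq V(G),\ |S|\le|V(G)|/2\}$. -}

module Defs where

open import Data.Nat using (ℕ; zero; suc; _+_; _*_; _∸_; _≤_)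
open import Data.Nat.Properties using ()
open import Data.Bool using (Bool; true; false; _∧_; _∨_; not; if_then_else_)
open import Data.Fin using (Fin; zero; suc)
open import Data.Fin.Properties using (_≟_)
open import Data.Product using (Σ; ∃; _×_; _,_)
open import Relation.Nullary.Decidable using (⌊_⌋)
open import Relation.Binary.PropositionalEquality using (_≡_)

∑ : ∀ {n} → (Fin n → ℕ) → ℕ
∑ {zero} f = 0
∑ {suc n} f = f zero + ∑ (λ i → f (suc i))

anyFin : ∀ {n} → (Fin n → Bool) → Bool
anyFin {zero} p = false
anyFin {suc n} p = p zero ∨ anyFin (λ i → p (suc i))

count : ∀ {n} → (Fin n → Bool) → ℕ
count p = ∑ (λ i → if p i then 1 else 0)

record Graph (n : ℕ) : Set where
  field
    adj   : Fin n → Fin n → Bool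
    sym   : ∀ x y → adj x y ≡ adj y x
    irrefl : ∀ x → adj x x ≡ false

module _ {n : ℕ} (G : Graph n) where
  open Graph G

  deg : Fin n → ℕ
  deg x = count (adj x)

  -- within m x y = true iff there is a walk of length ≤ m from x to y,
  -- i.e. d(x,y) ≤ m.
  within : ℕ → Fin n → Fin n → Bool
  within zero x y = ⌊ x ≟ y ⌋
  within (suc m) x y = within m x y ∨ anyFin (λ z → adj y z ∧ within m x z)

  distIs : ℕ → Fin n → Fin n → Bool
  distIs zero x y = within zero x y
  distIs (suc i) x y = within (suc i) x y ∧ not (within i x y)

  Regular : ℕ → Set
  Regular k = ∀ x → deg x ≡ k

  ConnectedWithDiameter : ℕ → Set
  ConnectedWithDiameter D =
    (∀ x y → within D x y ≡ true) ×
    (∃ λ x → ∃ λ y → distIs D x y ≡ true)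

  -- distance-regular: there are integers b_i, c_i such that for all x, y at
  -- distance i, y has c_i neighbours at distance i-1 from x and b_i
  -- neighbours at distance i+1 from x.  (c_0 is irrelevant; for i = 0 we
  -- count neighbours at "distance i-1" as none, i.e. only i ≥ 1 is constrained
  -- for c.)
  DistanceRegular : Set
  DistanceRegular =
    Σ (ℕ → ℕ) λ b → Σ (ℕ → ℕ) λ c →
      ∀ (i : ℕ) (x y : Fin n) → distIs i x y ≡ true →
        (count (λ z → adj y z ∧ distIs (suc i) x z) ≡ b i) ×
        (∀ j → i ≡ suc j → count (λ z → adj y z ∧ distIs j x z) ≡ c i)

  size : (Fin n → Bool) → ℕ
  size S = count S

  vol : (Fin n → Bool) → ℕ
  vol S = ∑ (λ x → if S x then deg x else 0)

  edgesOut : (Fin n → Bool) → ℕ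
  edgesOut S = ∑ (λ x → count (λ y → S x ∧ not (S y) ∧ adj x y))

  -- h_G ≤ p/q  (q > 0): since h_G is the minimum of E[S,S^c]/vol(S) over the
  -- finitely many nonempty S with |S| ≤ |V|/2, this holds iff some admissible
  -- S has E[S,S^c]/vol(S) ≤ p/q, i.e. q·E[S,S^c] ≤ p·vol(S) (vol(S) > 0).
  CheegerAtMost : ℕ → ℕ → Set
  CheegerAtMost p q =
    ∃ λ (S : Fin n → Bool) →
      (∃ λ x → S x ≡ true) × (2 * size S ≤ n) × (q * edgesOut S ≤ p * vol S)

module Submission where

-- Fix x, u with d(x,u) = D and let r be the least index with b_r ≤ k - 2
-- (it exists since b_D = 0, and r ≥ 1 since b_0 = k).  Let y be at distance
-- r from x on a geodesic to u, and P a geodesic from y back to x, starting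
-- with the neighbour d.  As b_r ≤ k - 2, y has a second neighbour w ≠ d in
-- B(x,r); let Q be a geodesic from w to x, of length l ≤ r.  The vertices
-- of P and Q form a closed walk S with |S| ≤ r + 1 + l in which every vertex
-- has two neighbours in S (the minimality of r makes P and Q reach x through
-- different neighbours).  In a k-regular graph such a set has
-- E[S,Sᶜ] ≤ (k-2)|S| = (k-2)/k · vol S.  Finally |S| ≤ |V|/2: below r we
-- have b_j ≥ k-1 and c_j ≤ 1, so the layers K_j around x satisfy
-- K_{j+1} c_{j+1} = K_j b_j and at least double, and a short case analysis
-- on r bounds 2(r + 1 + l) by |B(x,r)| + (D - r) ≤ |V|.

open import Defs
open import Data.Nat using (ℕ; zero; suc; pred; _+_; _*_; _∸_; _≤_; _<_; z≤n; s≤s; _≤?_)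
open import Data.Nat using () renaming (_≟_ to _≟ℕ_)
open import Data.Nat.Properties hiding (_≟_)
open import Data.Nat.Tactic.RingSolver using (solve-∀)
open import Data.Bool using (Bool; true; false; _∧_; _∨_; not; if_then_else_)
open import Data.Bool.Properties using (∧-zeroʳ; ∧-comm)
open import Data.Fin using (Fin) renaming (zero to fz; suc to fs)
open import Data.Fin.Properties using (_≟_)
open import Data.Product using (∃; _×_; _,_; proj₁; proj₂)
open import Data.Sum using (_⊎_; inj₁; inj₂; [_,_])
open import Data.Empty using (⊥; ⊥-elim)
open import Relation.Nullary using (¬_; Dec; yes; no)
open import Relation.Nullary.Decidable using (⌊_⌋)
open import Relation.Binary.Definitions using (tri<; tri≈; tri>)
open import Relation.Binary.PropositionalEquality
  using (_≡_; _≢_; refl; sym; trans; cong; cong₂; subst; subst₂; module ≡-Reasoning)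

∧-elimˡ : ∀ {a b} → (a ∧ b) ≡ true → a ≡ true
∧-elimˡ {true} _ = refl

∧-elimʳ : ∀ {a b} → (a ∧ b) ≡ true → b ≡ true
∧-elimʳ {true} e = e

∧-intro : ∀ {a b} → a ≡ true → b ≡ true → (a ∧ b) ≡ true
∧-intro refl refl = refl

∨-introˡ : ∀ {a b} → a ≡ true → (a ∨ b) ≡ true
∨-introˡ refl = refl

∨-introʳ : ∀ {a b} → b ≡ true → (a ∨ b) ≡ true
∨-introʳ {true} _ = refl
∨-introʳ {false} e = e

∨-elim : ∀ {a b} → (a ∨ b) ≡ true → a ≡ true ⊎ b ≡ true
∨-elim {true} _ = inj₁ refl
∨-elim {false} e = inj₂ e

not-elim : ∀ {a} → not a ≡ true → a ≡ false
not-elim {false} _ = refl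

not-intro : ∀ {a} → a ≡ false → not a ≡ true
not-intro refl = refl

true≢false : ∀ {a} → a ≡ true → a ≡ false → ⊥
true≢false refl ()

≟-refl : ∀ {n} (a : Fin n) → ⌊ a ≟ a ⌋ ≡ true
≟-refl a with a ≟ a
... | yes _ = refl
... | no a≢a = ⊥-elim (a≢a refl)

≟-sound : ∀ {n} {a b : Fin n} → ⌊ a ≟ b ⌋ ≡ true → a ≡ b
≟-sound {a = a} {b} e with a ≟ b
... | yes a≡b = a≡b

≟-distinct : ∀ {n} {a b : Fin n} → a ≢ b → ⌊ a ≟ b ⌋ ≡ false
≟-distinct {a = a} {b} a≢b with a ≟ b
... | yes a≡b = ⊥-elim (a≢b a≡b)
... | no _ = refl

∑-cong : ∀ {n} {f g : Fin n → ℕ} → (∀ i → f i ≡ g i) → ∑ f ≡ ∑ g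
∑-cong {zero} _ = refl
∑-cong {suc n} h = cong₂ _+_ (h fz) (∑-cong (λ i → h (fs i)))

∑-mono : ∀ {n} {f g : Fin n → ℕ} → (∀ i → f i ≤ g i) → ∑ f ≤ ∑ g
∑-mono {zero} _ = z≤n
∑-mono {suc n} h = +-mono-≤ (h fz) (∑-mono (λ i → h (fs i)))

∑-zero : ∀ {n} → ∑ {n} (λ _ → 0) ≡ 0
∑-zero {zero} = refl
∑-zero {suc n} = ∑-zero {n}

∑-+ : ∀ {n} (f g : Fin n → ℕ) → ∑ (λ i → f i + g i) ≡ ∑ f + ∑ g
∑-+ {zero} _ _ = refl
∑-+ {suc n} f g = trans (cong (f fz + g fz +_) (∑-+ (λ i → f (fs i)) (λ i → g (fs i))))
                        (interchange (f fz) (g fz) _ _)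
  where
  interchange : ∀ a b c d → a + b + (c + d) ≡ a + c + (b + d)
  interchange = solve-∀

∑-swap : ∀ {m n} (f : Fin m → Fin n → ℕ) → ∑ (λ i → ∑ (f i)) ≡ ∑ (λ j → ∑ (λ i → f i j))
∑-swap {zero} {n} _ = sym (∑-zero {n})
∑-swap {suc m} f = trans (cong (∑ (f fz) +_) (∑-swap (λ i → f (fs i))))
                         (sym (∑-+ (f fz) (λ j → ∑ (λ i → f (fs i) j))))

∑-constant-on : ∀ {n} (A : Fin n → Bool) (f : Fin n → ℕ) a → (∀ i → A i ≡ true → f i ≡ a) →
                ∑ (λ i → if A i then f i else 0) ≡ a * count A
∑-constant-on {zero} _ _ a _ = sym (*-zeroʳ a)
∑-constant-on {suc n} A f a h with A fz in e
... | true = trans (cong₂ _+_ (h fz e) (∑-constant-on (λ i → A (fs i)) (λ i → f (fs i)) a (λ i → h (fs i))))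
                   (sym (*-suc a _))
... | false = ∑-constant-on (λ i → A (fs i)) (λ i → f (fs i)) a (λ i → h (fs i))

𝟙 : Bool → ℕ
𝟙 b = if b then 1 else 0

count-cong : ∀ {n} {p q : Fin n → Bool} → (∀ i → p i ≡ q i) → count p ≡ count q
count-cong h = ∑-cong (λ i → cong 𝟙 (h i))

count-mono : ∀ {n} {p q : Fin n → Bool} → (∀ i → p i ≡ true → q i ≡ true) → count p ≤ count q
count-mono {p = p} {q} h = ∑-mono (λ i → 𝟙-mono (p i) (q i) (h i))
  where
  𝟙-mono : ∀ a b → (a ≡ true → b ≡ true) → 𝟙 a ≤ 𝟙 b
  𝟙-mono true b h rewrite h refl = ≤-refl
  𝟙-mono false b _ = z≤n

count-≤-size : ∀ {n} (p : Fin n → Bool) → count p ≤ n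
count-≤-size {zero} _ = z≤n
count-≤-size {suc n} p = +-mono-≤ (𝟙≤1 (p fz)) (count-≤-size (λ i → p (fs i)))
  where
  𝟙≤1 : ∀ b → 𝟙 b ≤ 1
  𝟙≤1 true = ≤-refl
  𝟙≤1 false = z≤n

count-empty : ∀ {n} (p : Fin n → Bool) → (∀ i → p i ≡ false) → count p ≡ 0
count-empty {n} p h = trans (count-cong h) (∑-zero {n})

count-split : ∀ {n} (p q : Fin n → Bool) → count p ≡ count (λ i → p i ∧ q i) + count (λ i → p i ∧ not (q i))
count-split p q = trans (∑-cong (λ i → split (p i) (q i))) (∑-+ (λ i → 𝟙 (p i ∧ q i)) (λ i → 𝟙 (p i ∧ not (q i))))
  where
  split : ∀ a b → 𝟙 a ≡ 𝟙 (a ∧ b) + 𝟙 (a ∧ not b)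
  split true true = refl
  split true false = refl
  split false _ = refl

count-∪ : ∀ {n} (p q : Fin n → Bool) → count (λ i → p i ∨ q i) ≤ count p + count q
count-∪ p q = ≤-trans (∑-mono (λ i → union (p i) (q i))) (≤-reflexive (∑-+ (λ i → 𝟙 (p i)) (λ i → 𝟙 (q i))))
  where
  union : ∀ a b → 𝟙 (a ∨ b) ≤ 𝟙 a + 𝟙 b
  union true _ = s≤s z≤n
  union false _ = ≤-refl

count-disjoint-∪ : ∀ {n} (p q : Fin n → Bool) → (∀ i → p i ≡ true → q i ≡ true → ⊥) →
                   count (λ i → p i ∨ q i) ≡ count p + count q
count-disjoint-∪ p q h = trans (∑-cong (λ i → union (p i) (q i) (h i))) (∑-+ (λ i → 𝟙 (p i)) (λ i → 𝟙 (q i)))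
  where
  union : ∀ a b → (a ≡ true → b ≡ true → ⊥) → 𝟙 (a ∨ b) ≡ 𝟙 a + 𝟙 b
  union true true h = ⊥-elim (h refl refl)
  union true false _ = refl
  union false _ _ = refl

count-witness : ∀ {n} (p : Fin n → Bool) i → p i ≡ true → 1 ≤ count p
count-witness p fz e rewrite e = s≤s z≤n
count-witness p (fs i) e = ≤-trans (count-witness (λ j → p (fs j)) i e) (m≤n+m _ (𝟙 (p fz)))

count-choose : ∀ {n} (p : Fin n → Bool) → 1 ≤ count p → ∃ λ i → p i ≡ true
count-choose {suc n} p h with p fz in e
... | true = fz , e
... | false = let (i , e′) = count-choose (λ j → p (fs j)) h in fs i , e′

count-singleton : ∀ {n} (a : Fin n) → count (λ i → ⌊ a ≟ i ⌋) ≡ 1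
count-singleton {suc n} fz = cong suc (count-empty {n} _ (λ _ → refl))
count-singleton {suc n} (fs a) = trans (count-cong (λ i → ≟-fs a i)) (count-singleton a)
  where
  ≟-fs : ∀ {n} (a b : Fin n) → ⌊ fs a ≟ fs b ⌋ ≡ ⌊ a ≟ b ⌋
  ≟-fs a b with a ≟ b
  ... | yes _ = refl
  ... | no _ = refl

count-two : ∀ {n} (p : Fin n → Bool) {a b} → a ≢ b → p a ≡ true → p b ≡ true → 2 ≤ count p
count-two p {a} {b} a≢b pa pb =
  subst (2 ≤_) (sym (count-split p (λ i → ⌊ a ≟ i ⌋)))
    (+-mono-≤ (count-witness _ a (∧-intro pa (≟-refl a)))
              (count-witness _ b (∧-intro pb (not-intro (≟-distinct a≢b)))))

count-other : ∀ {n} (p : Fin n → Bool) (d : Fin n) → 2 ≤ count p → ∃ λ w → p w ≡ true × d ≢ w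
count-other {n} p d h =
  w , ∧-elimˡ pw , λ d≡w → true≢false (subst (λ z → ⌊ d ≟ z ⌋ ≡ true) d≡w (≟-refl d)) (not-elim (∧-elimʳ pw))
  where
  at-d : count (λ i → p i ∧ ⌊ d ≟ i ⌋) ≤ 1
  at-d = ≤-trans (count-mono {q = λ i → ⌊ d ≟ i ⌋} (λ i e → ∧-elimʳ {p i} e)) (≤-reflexive (count-singleton d))
  off-d : 1 ≤ count (λ i → p i ∧ not ⌊ d ≟ i ⌋)
  off-d = +-cancelˡ-≤ 1 1 _ (≤-trans h (≤-trans (≤-reflexive (count-split p (λ i → ⌊ d ≟ i ⌋))) (+-monoˡ-≤ _ at-d)))
  w : Fin n
  w = proj₁ (count-choose (λ i → p i ∧ not ⌊ d ≟ i ⌋) off-d)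
  pw : (p w ∧ not ⌊ d ≟ w ⌋) ≡ true
  pw = proj₂ (count-choose (λ i → p i ∧ not ⌊ d ≟ i ⌋) off-d)

double-count : ∀ {n} (A B : Fin n → Bool) (E : Fin n → Fin n → Bool) → (∀ i j → E i j ≡ E j i) →
  ∑ (λ i → if A i then count (λ j → E i j ∧ B j) else 0) ≡ ∑ (λ j → if B j then count (λ i → E j i ∧ A i) else 0)
double-count {n} A B E E-sym = begin
    ∑ (λ i → if A i then count (λ j → E i j ∧ B j) else 0)
  ≡⟨ ∑-cong (λ i → guard (A i) (λ j → E i j ∧ B j)) ⟩
    ∑ (λ i → count (λ j → A i ∧ (E i j ∧ B j)))
  ≡⟨ ∑-cong (λ i → ∑-cong (λ j → cong 𝟙 (transpose i j))) ⟩
    ∑ (λ i → ∑ (λ j → 𝟙 (B j ∧ (E j i ∧ A i))))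
  ≡⟨ ∑-swap (λ i j → 𝟙 (B j ∧ (E j i ∧ A i))) ⟩
    ∑ (λ j → count (λ i → B j ∧ (E j i ∧ A i)))
  ≡⟨ ∑-cong (λ j → sym (guard (B j) (λ i → E j i ∧ A i))) ⟩
    ∑ (λ j → if B j then count (λ i → E j i ∧ A i) else 0) ∎
  where
  open ≡-Reasoning
  guard : ∀ a (p : Fin n → Bool) → (if a then count p else 0) ≡ count (λ j → a ∧ p j)
  guard true _ = refl
  guard false _ = sym (count-empty {n} (λ _ → false) (λ _ → refl))
  flip : ∀ a b e → (a ∧ (e ∧ b)) ≡ (b ∧ (e ∧ a))
  flip true true _ = refl
  flip true false e = ∧-zeroʳ e
  flip false true e = sym (∧-zeroʳ e)
  flip false false _ = refl
  transpose : ∀ i j → (A i ∧ (E i j ∧ B j)) ≡ (B j ∧ (E j i ∧ A i))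
  transpose i j = trans (flip (A i) (B j) (E i j)) (cong (λ e → B j ∧ (e ∧ A i)) (E-sym i j))

imageUpTo : ∀ {n} → (ℕ → Fin n) → ℕ → Fin n → Bool
imageUpTo f zero v = ⌊ f 0 ≟ v ⌋
imageUpTo f (suc m) v = imageUpTo f m v ∨ ⌊ f (suc m) ≟ v ⌋

imageUpTo-size : ∀ {n} (f : ℕ → Fin n) m → count (imageUpTo f m) ≤ suc m
imageUpTo-size f zero = ≤-reflexive (count-singleton (f 0))
imageUpTo-size f (suc m) = ≤-trans (count-∪ (imageUpTo f m) (λ v → ⌊ f (suc m) ≟ v ⌋))
  (≤-trans (+-mono-≤ (imageUpTo-size f m) (≤-reflexive (count-singleton (f (suc m)))))
           (≤-reflexive (+-comm (suc m) 1)))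

imageUpTo-∋ : ∀ {n} (f : ℕ → Fin n) {m} t → t ≤ m → imageUpTo f m (f t) ≡ true
imageUpTo-∋ f {zero} zero _ = ≟-refl (f 0)
imageUpTo-∋ f {suc m} t t≤ with t ≟ℕ suc m
... | yes refl = ∨-introʳ {imageUpTo f m (f (suc m))} (≟-refl (f (suc m)))
... | no t≢ = ∨-introˡ (imageUpTo-∋ f t (≤-pred (≤∧≢⇒< t≤ t≢)))

imageUpTo-∈ : ∀ {n} (f : ℕ → Fin n) m v → imageUpTo f m v ≡ true → ∃ λ t → t ≤ m × f t ≡ v
imageUpTo-∈ f zero v e = 0 , z≤n , ≟-sound e
imageUpTo-∈ f (suc m) v e with ∨-elim {imageUpTo f m v} e
... | inj₁ e′ = let (t , t≤ , ft≡v) = imageUpTo-∈ f m v e′ in t , m≤n⇒m≤1+n t≤ , ft≡v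
... | inj₂ e′ = suc m , ≤-refl , ≟-sound e′

anyFin-witness : ∀ {n} (p : Fin n → Bool) i → p i ≡ true → anyFin p ≡ true
anyFin-witness p fz e rewrite e = refl
anyFin-witness p (fs i) e = ∨-introʳ {p fz} (anyFin-witness (λ j → p (fs j)) i e)

anyFin-choose : ∀ {n} (p : Fin n → Bool) → anyFin p ≡ true → ∃ λ i → p i ≡ true
anyFin-choose {suc n} p e with p fz in e₀
... | true = fz , e₀
... | false = let (i , e′) = anyFin-choose (λ j → p (fs j)) e in fs i , e′

-- Walks and distances in a graph.  The boolean relations adj, within and
-- distIs are wrapped in data types so that their indices stay inferable.
module Distances {n : ℕ} (G : Graph n) where
  open Graph G using (adj; irrefl)

  data Adj (x y : Fin n) : Set where
    adj✓ : adj x y ≡ true → Adj x y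

  data Within (m : ℕ) (x y : Fin n) : Set where
    within✓ : within G m x y ≡ true → Within m x y

  data Dist (i : ℕ) (x y : Fin n) : Set where
    dist✓ : distIs G i x y ≡ true → Dist i x y

  adj-true : ∀ {x y} → Adj x y → adj x y ≡ true
  adj-true (adj✓ e) = e

  within-true : ∀ {m x y} → Within m x y → within G m x y ≡ true
  within-true (within✓ e) = e

  dist-true : ∀ {i x y} → Dist i x y → distIs G i x y ≡ true
  dist-true (dist✓ e) = e

  Adj-sym : ∀ {x y} → Adj x y → Adj y x
  Adj-sym {x} {y} (adj✓ e) = adj✓ (trans (Graph.sym G y x) e)

  Adj-distinct : ∀ {x y} → Adj x y → x ≢ y
  Adj-distinct {x} (adj✓ e) refl = true≢false e (irrefl x)

  within? : ∀ m x y → Within m x y ⊎ within G m x y ≡ false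
  within? m x y with within G m x y in e
  ... | true = inj₁ (within✓ e)
  ... | false = inj₂ refl

  Within-refl : ∀ x → Within 0 x x
  Within-refl x = within✓ (≟-refl x)

  Within-zero : ∀ {x y} → Within 0 x y → x ≡ y
  Within-zero (within✓ e) = ≟-sound e

  Within-suc : ∀ {m x y} → Within m x y → Within (suc m) x y
  Within-suc (within✓ e) = within✓ (∨-introˡ e)

  Within-mono : ∀ {m m′ x y} → m ≤ m′ → Within m x y → Within m′ x y
  Within-mono {m} {m′} {x} {y} m≤m′ w = subst (λ j → Within j x y) (m∸n+n≡m m≤m′) (pad (m′ ∸ m) w)
    where
    pad : ∀ e → Within m x y → Within (e + m) x y
    pad zero w = w
    pad (suc e) w = Within-suc (pad e w)

  Within-step : ∀ {m x y z} → Within m x z → Adj y z → Within (suc m) x y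
  Within-step {m} {x} {y} {z} (within✓ e) (adj✓ a) =
    within✓ (∨-introʳ {within G m x y} (anyFin-witness (λ v → adj y v ∧ within G m x v) z (∧-intro a e)))

  Within-extend : ∀ {i x z w} → Within i x z → Adj z w → Within (suc i) x w
  Within-extend w a = Within-step w (Adj-sym a)

  Within-last : ∀ {m x y} → Within (suc m) x y → Within m x y ⊎ (∃ λ z → Adj y z × Within m x z)
  Within-last {m} {x} {y} (within✓ e) with ∨-elim {within G m x y} e
  ... | inj₁ e′ = inj₁ (within✓ e′)
  ... | inj₂ e′ = let (z , ez) = anyFin-choose (λ v → adj y v ∧ within G m x v) e′
                  in inj₂ (z , adj✓ (∧-elimˡ ez) , within✓ (∧-elimʳ {adj y z} ez))

  Within-adj : ∀ {x y} → Adj x y → Within 1 x y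
  Within-adj {x} a = Within-step (Within-refl x) (Adj-sym a)

  Within-trans : ∀ {a b x y z} → Within a x y → Within b y z → Within (a + b) x z
  Within-trans {a} {zero} wxy wyz with Within-zero wyz
  ... | refl = subst (λ j → Within j _ _) (sym (+-identityʳ a)) wxy
  Within-trans {a} {suc b} {x} {z = z} wxy wyz = subst (λ j → Within j x z) (sym (+-suc a b)) last
    where
    last : Within (suc (a + b)) x z
    last with Within-last wyz
    ... | inj₁ w = Within-suc (Within-trans wxy w)
    ... | inj₂ (v , a , w) = Within-step (Within-trans wxy w) a

  Within-sym : ∀ {m x y} → Within m x y → Within m y x
  Within-sym {zero} w with Within-zero w
  ... | refl = w
  Within-sym {suc m} w with Within-last w
  ... | inj₁ w′ = Within-suc (Within-sym w′)
  ... | inj₂ (z , a , w′) = Within-trans {1} {m} (Within-adj a) (Within-sym w′)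

  Dist-within : ∀ {i x y} → Dist i x y → Within i x y
  Dist-within {zero} (dist✓ e) = within✓ e
  Dist-within {suc i} (dist✓ e) = within✓ (∧-elimˡ e)

  Dist-not-within : ∀ {i x y} → Dist (suc i) x y → ¬ Within i x y
  Dist-not-within {i} {x} {y} (dist✓ e) (within✓ e′) = true≢false e′ (not-elim (∧-elimʳ {within G (suc i) x y} e))

  Dist-intro : ∀ {i x y} → Within (suc i) x y → ¬ Within i x y → Dist (suc i) x y
  Dist-intro {i} {x} {y} (within✓ e) far with within? i x y
  ... | inj₁ w = ⊥-elim (far w)
  ... | inj₂ e′ = dist✓ (∧-intro e (not-intro e′))

  Dist-refl : ∀ x → Dist 0 x x
  Dist-refl x = dist✓ (≟-refl x)

  Dist-zero : ∀ {x y} → Dist 0 x y → x ≡ y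
  Dist-zero d = Within-zero (Dist-within d)

  Dist-minimal : ∀ {i m x y} → Dist i x y → m < i → ¬ Within m x y
  Dist-minimal {suc i} d (s≤s m≤i) w = Dist-not-within d (Within-mono m≤i w)

  Dist-exists : ∀ {m x y} → Within m x y → ∃ λ i → i ≤ m × Dist i x y
  Dist-exists {zero} (within✓ e) = 0 , z≤n , dist✓ e
  Dist-exists {suc m} {x} {y} w with within? m x y
  ... | inj₁ w′ = let (i , i≤m , d) = Dist-exists w′ in i , m≤n⇒m≤1+n i≤m , d
  ... | inj₂ e = suc m , ≤-refl , Dist-intro w (λ w′ → true≢false (within-true w′) e)

  Dist-unique : ∀ {i j x y} → Dist i x y → Dist j x y → i ≡ j
  Dist-unique {i} {j} dᵢ dⱼ with <-cmp i j
  ... | tri< i<j _ _ = ⊥-elim (Dist-minimal dⱼ i<j (Dist-within dᵢ))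
  ... | tri≈ _ i≡j _ = i≡j
  ... | tri> _ _ j<i = ⊥-elim (Dist-minimal dᵢ j<i (Dist-within dⱼ))

  Dist-distinct : ∀ {i j x a a′} → Dist i x a → Dist j x a′ → i ≢ j → a ≢ a′
  Dist-distinct dₐ dₐ′ i≢j refl = i≢j (Dist-unique dₐ dₐ′)

  Dist-descend : ∀ {j x z} → Dist (suc j) x z → ∃ λ w → Adj z w × Dist j x w
  Dist-descend {j} {x} {z} d with Within-last (Dist-within d)
  ... | inj₁ w = ⊥-elim (Dist-not-within d w)
  ... | inj₂ (w , a , wj) with Dist-exists wj
  ... | (i , i≤j , dᵢ) with i ≟ℕ j
  ... | yes refl = w , a , dᵢ
  ... | no i≢j = ⊥-elim (Dist-not-within d (Within-mono (≤∧≢⇒< i≤j i≢j) (Within-step (Dist-within dᵢ) a)))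

  neighbours-split : ∀ {i x z} → Within i x z →
    count (adj z) ≡ count (λ w → adj z w ∧ within G i x w) + count (λ w → adj z w ∧ distIs G (suc i) x w)
  neighbours-split {i} {x} {z} wz =
    trans (count-split (adj z) (within G i x)) (cong (count (λ w → adj z w ∧ within G i x w) +_) (count-cong outside))
    where
    outside : ∀ w → (adj z w ∧ not (within G i x w)) ≡ (adj z w ∧ distIs G (suc i) x w)
    outside w with adj z w in a
    ... | false = refl
    ... | true with Within-extend wz (adj✓ a)
    ... | within✓ e rewrite e = refl

  record Geodesic (x z : Fin n) (l : ℕ) : Set where
    field
      vertex  : ℕ → Fin n
      start   : vertex 0 ≡ z
      layered : ∀ t j → t + j ≡ l → Dist j x (vertex t)
      step    : ∀ t → t < l → Adj (vertex t) (vertex (suc t))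

  geodesic : ∀ {x z} l → Dist l x z → Geodesic x z l
  geodesic {x} {z} zero d = record { vertex = λ _ → z ; start = refl ; layered = layered ; step = λ _ () }
    where
    layered : ∀ t j → t + j ≡ 0 → Dist j x z
    layered zero zero _ = d
  geodesic {x} {z} (suc l) d = record { vertex = vertex ; start = refl ; layered = layered ; step = step }
    where
    next = Dist-descend d
    rest : Geodesic x (proj₁ next) l
    rest = geodesic l (proj₂ (proj₂ next))
    vertex : ℕ → Fin n
    vertex zero = z
    vertex (suc t) = Geodesic.vertex rest t
    layered : ∀ t j → t + j ≡ suc l → Dist j x (vertex t)
    layered zero j j≡ = subst (λ i → Dist i x z) (sym j≡) d
    layered (suc t) j t+j≡ = Geodesic.layered rest t j (suc-injective t+j≡)
    step : ∀ t → t < suc l → Adj (vertex t) (vertex (suc t))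
    step zero _ = subst (Adj z) (sym (Geodesic.start rest)) (proj₁ (proj₂ next))
    step (suc t) (s≤s t<l) = Geodesic.step rest t t<l

  module Geodesic-properties {x z l} (P : Geodesic x z l) where
    open Geodesic P

    dist : ∀ t → t ≤ l → Dist (l ∸ t) x (vertex t)
    dist t t≤l = layered t _ (m+[n∸m]≡n t≤l)

    end : vertex l ≡ x
    end = sym (Dist-zero (layered l 0 (+-identityʳ l)))

    segment : ∀ t m → t + m ≤ l → Within m (vertex t) (vertex (t + m))
    segment t zero _ = subst (λ s → Within 0 (vertex t) (vertex s)) (sym (+-identityʳ t)) (Within-refl _)
    segment t (suc m) t+m<l = subst (λ s → Within (suc m) (vertex t) (vertex s)) (sym (+-suc t m))
      (Within-step (segment t m (≤-trans (+-monoʳ-≤ t (n≤1+n m)) t+m<l))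
                   (Adj-sym (step (t + m) (subst (_≤ l) (+-suc t m) t+m<l))))

InnerDegree≥2 : ∀ {n} → Graph n → (Fin n → Bool) → Set
InnerDegree≥2 G S = ∀ v → S v ≡ true → 2 ≤ count (λ w → Graph.adj G v w ∧ S w)

module InnerDegreeBound {n} (G : Graph n) {k} (reg : Regular G k) where
  open Graph G using (adj)

  leaving-edges : ∀ {S} → InnerDegree≥2 G S → ∀ x →
    count (λ y → S x ∧ not (S y) ∧ adj x y) ≤ (if S x then k ∸ 2 else 0)
  leaving-edges {S} inner x with S x in e
  ... | false = ≤-reflexive (count-empty {n} (λ _ → false) (λ _ → refl))
  ... | true = begin
      count (λ y → not (S y) ∧ adj x y)  ≡⟨ count-cong (λ y → ∧-comm (not (S y)) (adj x y)) ⟩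
      outside                           ≡⟨ sym (m+n∸m≡n inside outside) ⟩
      inside + outside ∸ inside          ≡⟨ cong (_∸ inside) (trans (sym (count-split (adj x) S)) (reg x)) ⟩
      k ∸ inside                         ≤⟨ ∸-monoʳ-≤ k (inner x e) ⟩
      k ∸ 2                              ∎
    where
    open ≤-Reasoning
    inside outside : ℕ
    inside = count (λ y → adj x y ∧ S y)
    outside = count (λ y → adj x y ∧ not (S y))

  edgesOut-bound : ∀ {S} → InnerDegree≥2 G S → edgesOut G S ≤ (k ∸ 2) * size G S
  edgesOut-bound {S} inner =
    ≤-trans (∑-mono (leaving-edges inner)) (≤-reflexive (∑-constant-on S (λ _ → k ∸ 2) (k ∸ 2) (λ _ _ → refl)))

  vol-regular : ∀ S → vol G S ≡ k * size G S
  vol-regular S = ∑-constant-on S (deg G) k (λ x _ → reg x)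

  cheeger-bound : ∀ {S} → (∃ λ x → S x ≡ true) → 2 * size G S ≤ n → InnerDegree≥2 G S → CheegerAtMost G (k ∸ 2) k
  cheeger-bound {S} nonempty small inner = S , nonempty , small , (begin
      k * edgesOut G S              ≤⟨ *-monoʳ-≤ k (edgesOut-bound inner) ⟩
      k * ((k ∸ 2) * size G S)      ≡⟨ reassociate k (k ∸ 2) (size G S) ⟩
      (k ∸ 2) * (k * size G S)      ≡⟨ cong ((k ∸ 2) *_) (sym (vol-regular S)) ⟩
      (k ∸ 2) * vol G S             ∎)
    where
    open ≤-Reasoning
    reassociate : ∀ a b c → a * (b * c) ≡ b * (a * c)
    reassociate = solve-∀

balance-no-shrink : ∀ a {prev here c b′} → here * c ≡ prev * b′ → suc a ≤ b′ → c ≤ suc a → prev ≤ here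
balance-no-shrink a {prev} {here} {c} {b′} balance a<b′ c≤a = *-cancelʳ-≤ prev here (suc a) (begin
    prev * suc a  ≤⟨ *-monoʳ-≤ prev a<b′ ⟩
    prev * b′     ≡⟨ sym balance ⟩
    here * c      ≤⟨ *-monoʳ-≤ here c≤a ⟩
    here * suc a  ∎)
  where open ≤-Reasoning

-- With k = 3 + t: k(k-1) ≤ here·c and c ≤ k - 2 force here ≥ 5.
balance-≥5 : ∀ t {here c} → (3 + t) * (2 + t) ≤ here * c → c ≤ 1 + t → 5 ≤ here
balance-≥5 t {here} {c} large c≤ with 5 ≤? here
... | yes here≥5 = here≥5
... | no here≱5 = ⊥-elim (<⇒≱ small large)
  where
  expand : ∀ t → suc (4 * (1 + t)) + (1 + t + t * t) ≡ (3 + t) * (2 + t)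
  expand = solve-∀
  small : here * c < (3 + t) * (2 + t)
  small = begin-strict
    here * c                            ≤⟨ *-mono-≤ (≤-pred (≰⇒> here≱5)) c≤ ⟩
    4 * (1 + t)                         <⟨ n<1+n _ ⟩
    suc (4 * (1 + t))                   ≤⟨ m≤m+n _ _ ⟩
    suc (4 * (1 + t)) + (1 + t + t * t) ≡⟨ expand t ⟩
    (3 + t) * (2 + t)                   ∎
    where open ≤-Reasoning

-- With k = 3 + t: 5(k-1) ≤ here·c and c ≤ k force here ≥ 3.
balance-≥3 : ∀ t {here c} → 5 * (2 + t) ≤ here * c → c ≤ 3 + t → 3 ≤ here
balance-≥3 t {here} {c} large c≤ with 3 ≤? here
... | yes here≥3 = here≥3
... | no here≱3 = ⊥-elim (<⇒≱ small large)
  where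
  expand : ∀ t → suc (2 * (3 + t)) + (3 + 3 * t) ≡ 5 * (2 + t)
  expand = solve-∀
  small : here * c < 5 * (2 + t)
  small = begin-strict
    here * c                       ≤⟨ *-mono-≤ (≤-pred (≰⇒> here≱3)) c≤ ⟩
    2 * (3 + t)                    <⟨ n<1+n _ ⟩
    suc (2 * (3 + t))              ≤⟨ m≤m+n _ _ ⟩
    suc (2 * (3 + t)) + (3 + 3 * t) ≡⟨ expand t ⟩
    5 * (2 + t)                    ∎
    where open ≤-Reasoning

-- The numerical facts available at the first drop r of the sequence b,
-- seen from x: ball = |B(x,r-1)|, prev = K_{r-1}, here = K_r, cr = c_r,
-- br = b_r, bprev = b_{r-1}, and l = d(x,w) for the second neighbour w of y.
record DropData (k D r l ball prev here cr br bprev : ℕ) : Set where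
  field
    D≥3                : 3 ≤ D
    l≥1                : 1 ≤ l
    l≤r                : l ≤ r
    ball-size          : r * r ≤ ball
    prev-size          : 2 * (r ∸ 1) + 1 ≤ prev
    first-layer        : r ≡ 1 → k ≤ here
    second-layer       : r ≡ 2 → k ≤ prev
    balance            : here * cr ≡ prev * bprev
    bprev-large        : k ∸ 1 ≤ bprev
    valency            : cr + br ≤ k
    valency-same-layer : l ≡ r → suc (cr + br) ≤ k
    br-positive        : r < D → 1 ≤ br

module DropFacts {t D r l ball prev here cr br bprev} (h : DropData (3 + t) D r l ball prev here cr br bprev) where
  open DropData h

  no-shrink : cr ≤ 2 + t → prev ≤ here
  no-shrink = balance-no-shrink (1 + t) balance bprev-large

  room-inside : r < D → cr ≤ 2 + t
  room-inside r<D = m+n≤o⇒m≤o∸n cr (≤-trans (+-monoʳ-≤ cr (br-positive r<D)) valency)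

  room-same-layer : l ≡ r → cr ≤ 2 + t
  room-same-layer l≡r =
    m+n≤o⇒m≤o∸n cr (≤-trans (≤-reflexive (+-comm cr 1)) (≤-trans (s≤s (m≤m+n cr br)) (valency-same-layer l≡r)))

  room-both : l ≡ r → r < D → cr ≤ 1 + t
  room-both l≡r r<D =
    m+n≤o⇒m≤o∸n cr (≤-trans (+-monoʳ-≤ cr (s≤s (br-positive r<D)))
                            (≤-trans (≤-reflexive (+-suc cr br)) (valency-same-layer l≡r)))

  l-at-most : 2 * (r + 1 + l) ≤ 2 * (r + 1 + r)
  l-at-most = *-monoʳ-≤ 2 (+-monoʳ-≤ (r + 1) l≤r)

  l-below : l ≢ r → 2 * (r + 1 + l) ≤ 2 * (r + 1 + pred r)
  l-below l≢r = *-monoʳ-≤ 2 (+-monoʳ-≤ (r + 1) (<⇒≤pred (≤∧≢⇒< l≤r l≢r)))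

-- Then the set S fits twice into B(x,r) together with one vertex of each
-- further layer.  A case analysis on r: for r ≥ 5 the ball alone suffices,
-- for small r the layer K_r is bounded through the balance equation.
drop-count : ∀ {k D r l ball prev here cr br bprev} → 3 ≤ k →
  DropData k D r l ball prev here cr br bprev → 2 * (r + 1 + l) ≤ ball + here + (D ∸ r)
drop-count {r = zero} _ h = ⊥-elim (<⇒≱ (DropData.l≥1 h) (DropData.l≤r h))
drop-count {r = 1} (s≤s (s≤s (s≤s _))) h =
  ≤-trans l-at-most
    (+-mono-≤ (+-mono-≤ ball-size (≤-trans (s≤s (s≤s (s≤s z≤n))) (first-layer refl))) (∸-monoˡ-≤ 1 D≥3))
  where open DropData h; open DropFacts h
drop-count {r = 2} {l} {here = here} {cr} (s≤s (s≤s (s≤s (z≤n {t})))) h with l ≟ℕ 2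
... | yes refl = +-mono-≤ (+-mono-≤ ball-size (balance-≥5 t k·[k-1]≤ (room-both refl D≥3))) (∸-monoˡ-≤ 2 D≥3)
  where
  open DropData h; open DropFacts h
  k·[k-1]≤ : (3 + t) * (2 + t) ≤ here * cr
  k·[k-1]≤ = ≤-trans (*-mono-≤ (second-layer refl) bprev-large) (≤-reflexive (sym balance))
... | no l≢2 = ≤-trans (l-below l≢2)
                 (+-mono-≤ (+-mono-≤ ball-size (≤-trans prev-size (no-shrink (room-inside D≥3)))) (∸-monoˡ-≤ 2 D≥3))
  where open DropData h; open DropFacts h
drop-count {D = D} {r = 3} {l} {here = here} {cr} (s≤s (s≤s (s≤s (z≤n {t})))) h with l ≟ℕ 3
... | yes refl = ≤-trans (+-mono-≤ ball-size (≤-trans prev-size (no-shrink (room-same-layer refl)))) (m≤m+n _ (D ∸ 3))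
  where open DropData h; open DropFacts h
... | no l≢3 = ≤-trans (l-below l≢3)
                 (≤-trans (+-mono-≤ ball-size (balance-≥3 t 5·[k-1]≤ (≤-trans (m≤m+n _ _) valency))) (m≤m+n _ (D ∸ 3)))
  where
  open DropData h; open DropFacts h
  5·[k-1]≤ : 5 * (2 + t) ≤ here * cr
  5·[k-1]≤ = ≤-trans (*-mono-≤ prev-size bprev-large) (≤-reflexive (sym balance))
drop-count {D = D} {r = 4} {l} (s≤s (s≤s (s≤s (z≤n {t})))) h with l ≟ℕ 4
... | yes refl =
  ≤-trans (+-mono-≤ ball-size (≤-trans (≤-trans (s≤s (s≤s z≤n)) prev-size) (no-shrink (room-same-layer refl)))) (m≤m+n _ (D ∸ 4))
  where open DropData h; open DropFacts h
... | no l≢4 = ≤-trans (l-below l≢4) (≤-trans ball-size (≤-trans (m≤m+n _ _) (m≤m+n _ _)))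
  where open DropData h; open DropFacts h
drop-count {D = D} {r = suc (suc (suc (suc (suc s))))} {l} {ball} {here = here} (s≤s (s≤s (s≤s _))) h = begin
    2 * (5 + s + 1 + l)                 ≤⟨ l-at-most ⟩
    2 * (5 + s + 1 + (5 + s))           ≤⟨ m≤m+n _ (3 + s) ⟩
    2 * (5 + s + 1 + (5 + s)) + (3 + s) ≡⟨ expand s ⟩
    5 * (5 + s)                         ≤⟨ *-monoˡ-≤ (5 + s) (s≤s (s≤s (s≤s (s≤s (s≤s (z≤n {s})))))) ⟩
    (5 + s) * (5 + s)                   ≤⟨ ball-size ⟩
    ball                                ≤⟨ m≤m+n ball here ⟩
    ball + here                         ≤⟨ m≤m+n _ (D ∸ (5 + s)) ⟩
    ball + here + (D ∸ (5 + s))         ∎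
  where
  open DropData h
  open DropFacts h
  open ≤-Reasoning
  expand : ∀ s → 2 * (5 + s + 1 + (5 + s)) + (3 + s) ≡ 5 * (5 + s)
  expand = solve-∀

IntersectionArray : ∀ {n} → Graph n → (ℕ → ℕ) → (ℕ → ℕ) → Set
IntersectionArray {n} G b c = ∀ (i : ℕ) (x y : Fin n) → distIs G i x y ≡ true →
  (count (λ z → Graph.adj G y z ∧ distIs G (suc i) x z) ≡ b i) ×
  (∀ j → i ≡ suc j → count (λ z → Graph.adj G y z ∧ distIs G j x z) ≡ c i)

module Layers {n} (G : Graph n) {k} (reg : Regular G k) {b c : ℕ → ℕ} (array : IntersectionArray G b c) where
  open Graph G using (adj)
  open Distances G

  b-count : ∀ {i x y} → Dist i x y → count (λ z → adj y z ∧ distIs G (suc i) x z) ≡ b i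
  b-count {i} {x} {y} d = proj₁ (array i x y (dist-true d))

  c-count : ∀ {j x y} → Dist (suc j) x y → count (λ z → adj y z ∧ distIs G j x z) ≡ c (suc j)
  c-count {j} {x} {y} d = proj₂ (array (suc j) x y (dist-true d)) j refl

  inner : ℕ → Fin n → Fin n → ℕ
  inner i x y = count (λ z → adj y z ∧ within G i x z)

  inner+b≡k : ∀ {i x y} → Dist i x y → inner i x y + b i ≡ k
  inner+b≡k {i} {x} {y} d =
    trans (cong (inner i x y +_) (sym (b-count d))) (trans (sym (neighbours-split (Dist-within d))) (reg y))

  two-inner⇒b-small : ∀ {i x y} → Dist i x y → 2 ≤ inner i x y → b i ≤ k ∸ 2
  two-inner⇒b-small {i} d two =
    m+n≤o⇒m≤o∸n (b i) (≤-trans (≤-reflexive (+-comm (b i) 2))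
                                (≤-trans (+-monoˡ-≤ (b i) two) (≤-reflexive (inner+b≡k d))))

  b-small⇒two-inner : ∀ {i x y} → 2 ≤ k → Dist i x y → b i ≤ k ∸ 2 → 2 ≤ inner i x y
  b-small⇒two-inner {i} {x} {y} k≥2 d small = +-cancelʳ-≤ (b i) 2 (inner i x y) (begin
      2 + b i        ≤⟨ +-monoʳ-≤ 2 small ⟩
      2 + (k ∸ 2)    ≡⟨ m+[n∸m]≡n k≥2 ⟩
      k              ≡⟨ sym (inner+b≡k d) ⟩
      inner i x y + b i ∎)
    where open ≤-Reasoning

  -- If b_{j+1} ≥ k - 1 then c_{j+1} ≤ 1: the layer below lies in the ball.
  c-small : ∀ {j x z} → Dist (suc j) x z → k ∸ 1 ≤ b (suc j) → c (suc j) ≤ 1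
  c-small {j} {x} {z} d large = begin
      c (suc j)                             ≡⟨ sym (c-count d) ⟩
      count (λ v → adj z v ∧ distIs G j x v) ≤⟨ count-mono below⊆ball ⟩
      inner (suc j) x z                     ≤⟨ m+n≤o⇒m≤o∸n _ (≤-reflexive (inner+b≡k d)) ⟩
      k ∸ b (suc j)                         ≤⟨ ∸-monoʳ-≤ k large ⟩
      k ∸ (k ∸ 1)                           ≤⟨ m∸pred≤1 k ⟩
      1                                     ∎
    where
    open ≤-Reasoning
    below⊆ball : ∀ v → (adj z v ∧ distIs G j x v) ≡ true → (adj z v ∧ within G (suc j) x v) ≡ true
    below⊆ball v e = ∧-intro (∧-elimˡ e) (within-true (Within-suc (Dist-within {j} {x} {v} (dist✓ (∧-elimʳ {adj z v} e)))))
    m∸pred≤1 : ∀ m → m ∸ (m ∸ 1) ≤ 1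
    m∸pred≤1 zero = z≤n
    m∸pred≤1 (suc m) = ≤-reflexive (m∸[m∸n]≡n {suc m} (s≤s z≤n))

  Layer : Fin n → ℕ → ℕ
  Layer x j = count (distIs G j x)

  Ball : Fin n → ℕ → ℕ
  Ball x m = count (within G m x)

  Layer-zero : ∀ x → Layer x 0 ≡ 1
  Layer-zero x = count-singleton x

  Ball-suc : ∀ x m → Ball x (suc m) ≡ Ball x m + Layer x (suc m)
  Ball-suc x m = trans (count-cong split) (count-disjoint-∪ (within G m x) (distIs G (suc m) x) disjoint)
    where
    disjoint : ∀ z → within G m x z ≡ true → distIs G (suc m) x z ≡ true → ⊥
    disjoint z e e′ = Dist-not-within {m} {x} {z} (dist✓ e′) (within✓ e)
    decompose : ∀ a a′ → (a ≡ true → a′ ≡ true) → a′ ≡ (a ∨ (a′ ∧ not a))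
    decompose true _ h = h refl
    decompose false true _ = refl
    decompose false false _ = refl
    split : ∀ z → within G (suc m) x z ≡ (within G m x z ∨ distIs G (suc m) x z)
    split z = decompose (within G m x z) (within G (suc m) x z) (λ e → within-true (Within-suc {m} {x} {z} (within✓ e)))

  b-zero : ∀ x → b 0 ≡ k
  b-zero x = trans (sym (b-count (Dist-refl x))) (trans (count-cong away) (reg x))
    where
    away : ∀ z → (adj x z ∧ distIs G 1 x z) ≡ adj x z
    away z with adj x z in a
    ... | false = refl
    ... | true with within? 0 x z
    ...   | inj₁ w = ⊥-elim (Adj-distinct (adj✓ a) (Within-zero w))
    ...   | inj₂ e = dist-true (Dist-intro (Within-adj (adj✓ a)) (λ w → true≢false (within-true w) e))

  b-diameter : ∀ {D x u} → (∀ x y → within G D x y ≡ true) → Dist D x u → b D ≡ 0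
  b-diameter {D} {x} {u} connected xu = trans (sym (b-count xu)) (count-empty _ beyond)
    where
    beyond : ∀ z → (adj u z ∧ distIs G (suc D) x z) ≡ false
    beyond z rewrite connected x z = ∧-zeroʳ (adj u z)

  -- Double counting the edges between layers j and j + 1.
  Layer-balance : ∀ x j → Layer x (suc j) * c (suc j) ≡ Layer x j * b j
  Layer-balance x j = begin
      Layer x (suc j) * c (suc j)
    ≡⟨ *-comm (Layer x (suc j)) (c (suc j)) ⟩
      c (suc j) * Layer x (suc j)
    ≡⟨ sym (∑-constant-on (distIs G (suc j) x) down (c (suc j)) (λ z e → c-count (dist✓ e))) ⟩
      ∑ (λ z → if distIs G (suc j) x z then down z else 0)
    ≡⟨ double-count (distIs G (suc j) x) (distIs G j x) adj (Graph.sym G) ⟩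
      ∑ (λ z → if distIs G j x z then up z else 0)
    ≡⟨ ∑-constant-on (distIs G j x) up (b j) (λ z e → b-count (dist✓ e)) ⟩
      b j * Layer x j
    ≡⟨ *-comm (b j) (Layer x j) ⟩
      Layer x j * b j ∎
    where
    open ≡-Reasoning
    down up : Fin n → ℕ
    down z = count (λ v → adj z v ∧ distIs G j x v)
    up z = count (λ v → adj z v ∧ distIs G (suc j) x v)

  -- The first layer has k vertices (at least): K_1 c_1 = K_0 b_0 = k and c_1 ≤ 1.
  Layer-one : ∀ {x z} → Dist 1 x z → k ≤ Layer x 1
  Layer-one {x} {z} xz = begin
      k                       ≡⟨ sym (trans (Layer-balance x 0) (trans (cong₂ _*_ (Layer-zero x) (b-zero x)) (+-identityʳ k))) ⟩
      Layer x 1 * c 1         ≤⟨ *-monoʳ-≤ (Layer x 1) c₁≤1 ⟩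
      Layer x 1 * 1           ≡⟨ *-identityʳ (Layer x 1) ⟩
      Layer x 1               ∎
    where
    open ≤-Reasoning
    c₁≤1 : c 1 ≤ 1
    c₁≤1 = ≤-trans (≤-reflexive (sym (c-count xz)))
             (≤-trans (count-mono (λ v e → ∧-elimʳ {adj z v} e)) (≤-reflexive (Layer-zero x)))

  module FirstDrop (k≥3 : 3 ≤ k) {D} (D≥3 : 3 ≤ D) {x u : Fin n} (xu : Dist D x u)
                   {r} (r≤D : r ≤ D) (drop : b r ≤ k ∸ 2) (before : ∀ j → j < r → ¬ b j ≤ k ∸ 2) where

    k≥2 : 2 ≤ k
    k≥2 = ≤-trans (s≤s (s≤s z≤n)) k≥3

    -- r ≥ 1, since b_0 = k.
    r≥1 : 1 ≤ r
    r≥1 = positive drop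
      where
      positive : ∀ {j} → b j ≤ k ∸ 2 → 1 ≤ j
      positive {zero} small = ⊥-elim (<⇒≱ (∸-monoʳ-< {k} {2} {0} (s≤s z≤n) k≥2) (subst (_≤ k ∸ 2) (b-zero x) small))
      positive {suc _} _ = s≤s z≤n

    r₁ : ℕ
    r₁ = r ∸ 1

    r₁+1≡r : suc r₁ ≡ r
    r₁+1≡r = m+[n∸m]≡n r≥1

    r₁<r : r₁ < r
    r₁<r = subst (r₁ <_) r₁+1≡r ≤-refl

    b-before : ∀ j → j < r → k ∸ 1 ≤ b j
    b-before j j<r with b j ≤? k ∸ 2
    ... | yes small = ⊥-elim (before j j<r small)
    ... | no large = subst (_≤ b j) (sym (+-∸-assoc 1 k≥2)) (≰⇒> large)

    spine-geodesic : Geodesic x u D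
    spine-geodesic = geodesic D xu

    spine : ℕ → Fin n
    spine j = Geodesic.vertex spine-geodesic (D ∸ j)

    spine-dist : ∀ {j} → j ≤ D → Dist j x (spine j)
    spine-dist {j} j≤D = subst (λ i → Dist i x (spine j)) (m∸[m∸n]≡n j≤D) (dist (D ∸ j) (m∸n≤m D j))
      where open Geodesic-properties spine-geodesic

    spine-adj : ∀ {j} → j < D → Adj (spine j) (spine (suc j))
    spine-adj {j} j<D = subst (λ i → Adj (Geodesic.vertex spine-geodesic i) (spine (suc j))) (sym (+-∸-assoc 1 j<D))
      (Adj-sym (Geodesic.step spine-geodesic (D ∸ suc j) (∸-monoʳ-< {D} {suc j} {0} (s≤s z≤n) j<D)))

    Layer-positive : ∀ {j} → j ≤ D → 1 ≤ Layer x j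
    Layer-positive {j} j≤D = count-witness (distIs G j x) (spine j) (dist-true (spine-dist j≤D))

    -- Every layer up to D is nonempty, so |B(x,m+e)| ≥ |B(x,m)| + e.
    Ball-tail : ∀ m e → m + e ≤ D → Ball x m + e ≤ Ball x (m + e)
    Ball-tail m zero _ = ≤-reflexive (trans (+-identityʳ _) (cong (Ball x) (sym (+-identityʳ m))))
    Ball-tail m (suc e) m+e<D = begin
        Ball x m + suc e                          ≡⟨ trans (+-suc (Ball x m) e) (+-comm 1 _) ⟩
        Ball x m + e + 1                          ≤⟨ +-mono-≤ (Ball-tail m e (≤-trans (+-monoʳ-≤ m (n≤1+n e)) m+e<D))
                                                              (Layer-positive (subst (_≤ D) (+-suc m e) m+e<D)) ⟩
        Ball x (m + e) + Layer x (suc (m + e))    ≡⟨ sym (Ball-suc x (m + e)) ⟩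
        Ball x (suc (m + e))                      ≡⟨ cong (Ball x) (sym (+-suc m e)) ⟩
        Ball x (m + suc e)                        ∎
      where open ≤-Reasoning

    -- Below the drop the layers at least double: K_{j+1} ≥ K_{j+1} c_{j+1} = K_j b_j ≥ 2 K_j.
    Layer-doubling : ∀ j → suc j < r → 2 * Layer x j ≤ Layer x (suc j)
    Layer-doubling j j+1<r = begin
        2 * Layer x j                  ≡⟨ *-comm 2 (Layer x j) ⟩
        Layer x j * 2                  ≤⟨ *-monoʳ-≤ (Layer x j) b≥2 ⟩
        Layer x j * b j                ≡⟨ sym (Layer-balance x j) ⟩
        Layer x (suc j) * c (suc j)    ≤⟨ *-monoʳ-≤ (Layer x (suc j)) c≤1 ⟩
        Layer x (suc j) * 1            ≡⟨ *-identityʳ _ ⟩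
        Layer x (suc j)                ∎
      where
      open ≤-Reasoning
      b≥2 : 2 ≤ b j
      b≥2 = ≤-trans (∸-monoˡ-≤ 1 k≥3) (b-before j (<-trans (n<1+n j) j+1<r))
      c≤1 : c (suc j) ≤ 1
      c≤1 = c-small (spine-dist (≤-trans (<⇒≤ j+1<r) r≤D)) (b-before (suc j) j+1<r)

    Growth : ℕ → Set
    Growth j = suc j * suc j ≤ Ball x j × 2 * j + 1 ≤ Layer x j

    growth-step : ∀ j → suc (suc j) < r → Growth (suc j) → Growth (suc (suc j))
    growth-step j j+2<r (ball , layer) = ball′ , layer′
      where
      twice : ∀ j → 2 * suc (suc j) + 1 + (1 + 2 * j) ≡ 2 * (2 * suc j + 1)
      twice = solve-∀
      square : ∀ j → suc (suc (suc j)) * suc (suc (suc j)) ≡ suc (suc j) * suc (suc j) + (2 * suc (suc j) + 1)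
      square = solve-∀
      layer′ : 2 * suc (suc j) + 1 ≤ Layer x (suc (suc j))
      layer′ = ≤-trans (m≤m+n _ (1 + 2 * j)) (≤-trans (≤-reflexive (twice j))
                 (≤-trans (*-monoʳ-≤ 2 layer) (Layer-doubling (suc j) j+2<r)))
      ball′ : suc (suc (suc j)) * suc (suc (suc j)) ≤ Ball x (suc (suc j))
      ball′ = ≤-trans (≤-reflexive (square j)) (≤-trans (+-mono-≤ ball layer′) (≤-reflexive (sym (Ball-suc x (suc j)))))

    growth : ∀ j → j < r → Growth j
    growth zero _ = ≤-reflexive (sym (Layer-zero x)) , ≤-reflexive (sym (Layer-zero x))
    growth (suc zero) _ =
      ≤-trans (+-mono-≤ (≤-reflexive (sym (Layer-zero x))) K₁≥3) (≤-reflexive (sym (Ball-suc x 0))) , K₁≥3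
      where
      K₁≥3 : 3 ≤ Layer x 1
      K₁≥3 = ≤-trans k≥3 (Layer-one (spine-dist (≤-trans (s≤s z≤n) D≥3)))
    growth (suc (suc j)) j+2<r = growth-step j j+2<r (growth (suc j) (<-trans (n<1+n (suc j)) j+2<r))

    y : Fin n
    y = spine r

    xy : Dist r x y
    xy = spine-dist r≤D

    P-geodesic : Geodesic x y r
    P-geodesic = geodesic r xy

    P : ℕ → Fin n
    P = Geodesic.vertex P-geodesic

    module P = Geodesic-properties P-geodesic

    d : Fin n
    d = P 1

    y∼d : Adj y d
    y∼d = subst (λ v → Adj v d) (Geodesic.start P-geodesic) (Geodesic.step P-geodesic 0 r≥1)

    -- Since b_r ≤ k - 2, y has a second neighbour w ≠ d in B(x,r); let l = d(x,w) ≤ r.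
    -- These choices are abstract: their computational content is irrelevant and
    -- costly to unfold.
    abstract
      second-neighbour : ∃ λ w → (adj y w ∧ within G r x w) ≡ true × d ≢ w
      second-neighbour = count-other (λ z → adj y z ∧ within G r x z) d (b-small⇒two-inner k≥2 xy drop)

      w : Fin n
      w = proj₁ second-neighbour

      y∼w : Adj y w
      y∼w = adj✓ (∧-elimˡ (proj₁ (proj₂ second-neighbour)))

      w-in-ball : Within r x w
      w-in-ball = within✓ (∧-elimʳ {adj y w} (proj₁ (proj₂ second-neighbour)))

      d≢w : d ≢ w
      d≢w = proj₂ (proj₂ second-neighbour)

      l : ℕ
      l = proj₁ (Dist-exists w-in-ball)

      l≤r : l ≤ r
      l≤r = proj₁ (proj₂ (Dist-exists w-in-ball))

      xw : Dist l x w
      xw = proj₂ (proj₂ (Dist-exists w-in-ball))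

    -- l ≥ 1: were w = x, then r = 1 and d = x = w.
    l≥1 : 1 ≤ l
    l≥1 = positive xw
      where
      positive : ∀ {j} → Dist j x w → 1 ≤ j
      positive {suc _} _ = s≤s z≤n
      positive {zero} xw₀ = ⊥-elim (d≢w (trans (sym x≡d) (Dist-zero xw₀)))
        where
        r≤1 : r ≤ 1
        r≤1 with r ≤? 1
        ... | yes r≤1 = r≤1
        ... | no r≰1 = ⊥-elim (Dist-minimal xy (≰⇒> r≰1)
                          (Within-step (subst (Within 0 x) (Dist-zero xw₀) (Within-refl x)) y∼w))
        x≡d : x ≡ d
        x≡d = Dist-zero (subst (λ i → Dist i x d) (m≤n⇒m∸n≡0 r≤1) (P.dist 1 r≥1))

    Q-geodesic : Geodesic x w l
    Q-geodesic = geodesic l xw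

    Q : ℕ → Fin n
    Q = Geodesic.vertex Q-geodesic

    module Q = Geodesic-properties Q-geodesic

    l₀ : ℕ
    l₀ = l ∸ 1

    l₀+1≡l : suc l₀ ≡ l
    l₀+1≡l = m+[n∸m]≡n l≥1

    l₀<l : l₀ < l
    l₀<l = subst (l₀ <_) l₀+1≡l ≤-refl

    -- The cycle y = P 0, …, P r = x = Q l, Q l₀, …, Q 0 = w (∼ y).
    S : Fin n → Bool
    S v = imageUpTo P r v ∨ imageUpTo Q l₀ v

    P-in-S : ∀ t → t ≤ r → S (P t) ≡ true
    P-in-S t t≤r = ∨-introˡ (imageUpTo-∋ P t t≤r)

    Q-in-S : ∀ t → t ≤ l₀ → S (Q t) ≡ true
    Q-in-S t t≤l₀ = ∨-introʳ {imageUpTo P r (Q t)} (imageUpTo-∋ Q t t≤l₀)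

    Q-next-in-S : ∀ t → t ≤ l₀ → S (Q (suc t)) ≡ true
    Q-next-in-S t t≤l₀ = [ Q-in-S (suc t) , at-x ] (next-index t≤l₀)
      where
      next-index : t ≤ l₀ → suc t ≤ l₀ ⊎ suc t ≡ l
      next-index t≤l₀ with suc t ≤? l₀
      ... | yes t<l₀ = inj₁ t<l₀
      ... | no t≮l₀ = inj₂ (trans (cong suc (≤-antisym t≤l₀ (≤-pred (≰⇒> t≮l₀)))) l₀+1≡l)
      at-x : suc t ≡ l → S (Q (suc t)) ≡ true
      at-x t+1≡l = subst (λ v → S v ≡ true) (trans P.end (sym (trans (cong Q t+1≡l) Q.end))) (P-in-S r ≤-refl)

    S-size : count S ≤ r + 1 + l
    S-size = begin
      count S                                   ≤⟨ count-∪ (imageUpTo P r) (imageUpTo Q l₀) ⟩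
      count (imageUpTo P r) + count (imageUpTo Q l₀) ≤⟨ +-mono-≤ (imageUpTo-size P r) (imageUpTo-size Q l₀) ⟩
      suc r + suc l₀                            ≡⟨ cong₂ _+_ (+-comm 1 r) l₀+1≡l ⟩
      r + 1 + l                                 ∎
      where open ≤-Reasoning

    two-in-S : ∀ {v a a′} → Adj v a → Adj v a′ → a ≢ a′ → S a ≡ true → S a′ ≡ true →
               2 ≤ count (λ z → adj v z ∧ S z)
    two-in-S {v} (adj✓ e) (adj✓ e′) a≢a′ sa sa′ =
      count-two (λ z → adj v z ∧ S z) a≢a′ (∧-intro e sa) (∧-intro e′ sa′)

    layers-differ : ∀ {m a a′} → a ≤ m → a′ ≤ m → a ≢ a′ → m ∸ a ≢ m ∸ a′
    layers-differ a≤m a′≤m a≢a′ eq = a≢a′ (∸-cancelˡ-≡ a≤m a′≤m eq)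

    -- The two geodesics reach x through different neighbours.  Otherwise
    -- v = P (r-1) = Q l₀ is a neighbour of x from which y is at distance r - 1
    -- with both d and w in B(v, r-1), so b_{r-1} ≤ k - 2 against the
    -- minimality of r.  (For r = 1 it would give y = P 0 = Q 0 = w.)
    arrive-differently : ∀ j → suc j ≡ r → P j ≢ Q l₀
    arrive-differently zero 1≡r y≡Q = Adj-distinct y∼w (begin
        y      ≡⟨ sym (Geodesic.start P-geodesic) ⟩
        P 0    ≡⟨ y≡Q ⟩
        Q l₀   ≡⟨ cong Q l₀≡0 ⟩
        Q 0    ≡⟨ Geodesic.start Q-geodesic ⟩
        w      ∎)
      where
      open ≡-Reasoning
      l₀≡0 : l₀ ≡ 0
      l₀≡0 = n≤0⇒n≡0 (≤-pred (≤-trans l₀<l (subst (l ≤_) (sym 1≡r) l≤r)))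
    arrive-differently (suc j) j+2≡r v≡Q = before (suc j) j+1<r (two-inner⇒b-small vy two)
      where
      v : Fin n
      v = P (suc j)
      j+1<r : suc j < r
      j+1<r = subst (suc j <_) j+2≡r ≤-refl
      v∼d : Within j v d
      v∼d = Within-sym (P.segment 1 j (<⇒≤ j+1<r))
      v∼w : Within l₀ v w
      v∼w = Within-sym (subst₂ (Within l₀) (Geodesic.start Q-geodesic) (sym v≡Q) (Q.segment 0 l₀ (<⇒≤ l₀<l)))
      x∼v : Within 1 x v
      x∼v = Within-adj (subst (λ a → Adj a v) (trans (cong P j+2≡r) P.end) (Adj-sym (Geodesic.step P-geodesic (suc j) j+1<r)))
      vy : Dist (suc j) v y
      vy = Dist-intro (Within-step v∼d y∼d) (λ near → Dist-minimal xy j+1<r (Within-trans {1} {j} x∼v near))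
      l₀≤j+1 : l₀ ≤ suc j
      l₀≤j+1 = ≤-pred (≤-trans l₀<l (subst (l ≤_) (sym j+2≡r) l≤r))
      two : 2 ≤ inner (suc j) v y
      two = count-two (λ z → adj y z ∧ within G (suc j) v z) d≢w
              (∧-intro (adj-true y∼d) (within-true (Within-suc v∼d)))
              (∧-intro (adj-true y∼w) (within-true (Within-mono l₀≤j+1 v∼w)))

    -- x = P r has the neighbours P (r-1) and Q l₀ in S.
    x-inner : ∀ t → suc t ≡ r → 2 ≤ count (λ z → adj (P (suc t)) z ∧ S z)
    x-inner t t+1≡r = two-in-S (Adj-sym (Geodesic.step P-geodesic t t<r)) x∼Q (arrive-differently t t+1≡r)
                               (P-in-S t (<⇒≤ t<r)) (Q-in-S l₀ ≤-refl)
      where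
      t<r : t < r
      t<r = subst (t <_) t+1≡r ≤-refl
      Q-end≡P : Q (suc l₀) ≡ P (suc t)
      Q-end≡P = trans (cong Q l₀+1≡l) (trans Q.end (sym (trans (cong P t+1≡r) P.end)))
      x∼Q : Adj (P (suc t)) (Q l₀)
      x∼Q = subst (λ a → Adj a (Q l₀)) Q-end≡P (Adj-sym (Geodesic.step Q-geodesic l₀ l₀<l))

    -- y = P 0 has d and w; an inner P t has P (t-1) and P (t+1) on other layers.
    P-inner : ∀ t → t ≤ r → 2 ≤ count (λ z → adj (P t) z ∧ S z)
    P-inner zero _ = two-in-S (Geodesic.step P-geodesic 0 r≥1) P₀∼Q₀
                              (λ d≡Q₀ → d≢w (trans d≡Q₀ (Geodesic.start Q-geodesic)))
                              (P-in-S 1 r≥1) (Q-in-S 0 z≤n)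
      where
      P₀∼Q₀ : Adj (P 0) (Q 0)
      P₀∼Q₀ = subst₂ Adj (sym (Geodesic.start P-geodesic)) (sym (Geodesic.start Q-geodesic)) y∼w
    P-inner (suc t) t+1≤r with suc t ≟ℕ r
    ... | yes t+1≡r = x-inner t t+1≡r
    ... | no t+1≢r = two-in-S (Adj-sym (Geodesic.step P-geodesic t t+1≤r)) (Geodesic.step P-geodesic (suc t) t+1<r)
                              (Dist-distinct (P.dist t t≤r) (P.dist (suc (suc t)) t+1<r)
                                             (layers-differ t≤r t+1<r (<⇒≢ (<-trans (n<1+n t) (n<1+n (suc t))))))
                              (P-in-S t t≤r) (P-in-S (suc (suc t)) t+1<r)
      where
      t+1<r : suc t < r
      t+1<r = ≤∧≢⇒< t+1≤r t+1≢r
      t≤r : t ≤ r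
      t≤r = ≤-trans (n≤1+n t) t+1≤r

    -- w = Q 0 has y and Q 1; an inner Q t has Q (t-1) and Q (t+1).
    Q-inner : ∀ t → t ≤ l₀ → 2 ≤ count (λ z → adj (Q t) z ∧ S z)
    Q-inner zero _ = two-in-S (Geodesic.step Q-geodesic 0 l≥1) Q₀∼y
                              (Dist-distinct (Q.dist 1 l≥1) xy (<⇒≢ (<-≤-trans l₀<l l≤r)))
                              (Q-next-in-S 0 z≤n) (subst (λ v → S v ≡ true) (Geodesic.start P-geodesic) (P-in-S 0 z≤n))
      where
      Q₀∼y : Adj (Q 0) y
      Q₀∼y = subst (λ v → Adj v y) (sym (Geodesic.start Q-geodesic)) (Adj-sym y∼w)
    Q-inner (suc t) t+1≤l₀ = two-in-S (Geodesic.step Q-geodesic (suc t) t+1<l) (Adj-sym (Geodesic.step Q-geodesic t t<l))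
                                      (Dist-distinct (Q.dist (suc (suc t)) t+1<l) (Q.dist t t≤l)
                                                     (layers-differ t+1<l t≤l (λ e → <⇒≢ (<-trans (n<1+n t) (n<1+n (suc t))) (sym e))))
                                      (Q-next-in-S (suc t) t+1≤l₀) (Q-in-S t (≤-trans (n≤1+n t) t+1≤l₀))
      where
      t+1<l : suc t < l
      t+1<l = subst (suc (suc t) ≤_) l₀+1≡l (s≤s t+1≤l₀)
      t<l : t < l
      t<l = <-trans (n<1+n t) t+1<l
      t≤l : t ≤ l
      t≤l = <⇒≤ t<l

    S-inner-degree : InnerDegree≥2 G S
    S-inner-degree v v∈S with ∨-elim {imageUpTo P r v} v∈S
    ... | inj₁ e = let (t , t≤r , Pt≡v) = imageUpTo-∈ P r v e
                   in subst (λ a → 2 ≤ count (λ z → adj a z ∧ S z)) Pt≡v (P-inner t t≤r)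
    ... | inj₂ e = let (t , t≤l₀ , Qt≡v) = imageUpTo-∈ Q l₀ v e
                   in subst (λ a → 2 ≤ count (λ z → adj a z ∧ S z)) Qt≡v (Q-inner t t≤l₀)

    -- The layer data at r.  The c_r neighbours of y one layer down lie in B(x,r);
    -- when l = r, w is a further neighbour of y in B(x,r).
    xy′ : Dist (suc r₁) x y
    xy′ = subst (λ i → Dist i x y) (sym r₁+1≡r) xy

    c-neighbours : count (λ z → adj y z ∧ distIs G r₁ x z) ≡ c r
    c-neighbours = trans (c-count xy′) (cong c r₁+1≡r)

    below⊆ball : ∀ z → (adj y z ∧ distIs G r₁ x z) ≡ true → (adj y z ∧ within G r x z) ≡ true
    below⊆ball z e =
      ∧-intro (∧-elimˡ e) (within-true (Within-mono (<⇒≤ r₁<r) (Dist-within {r₁} {x} {z} (dist✓ (∧-elimʳ {adj y z} e)))))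

    valency : c r + b r ≤ k
    valency = ≤-trans (+-monoˡ-≤ (b r) (≤-trans (≤-reflexive (sym c-neighbours)) (count-mono below⊆ball)))
                      (≤-reflexive (inner+b≡k xy))

    valency-same-layer : l ≡ r → suc (c r + b r) ≤ k
    valency-same-layer l≡r = ≤-trans (+-monoˡ-≤ (b r) c+1≤inner) (≤-reflexive (inner+b≡k xy))
      where
      A : Fin n → Bool
      A z = adj y z ∧ within G r x z
      w-not-below : distIs G r₁ x w ≡ false
      w-not-below with distIs G r₁ x w in e
      ... | false = refl
      ... | true = ⊥-elim (<-irrefl (trans (Dist-unique (dist✓ e) xw) l≡r) r₁<r)
      c+1≤inner : suc (c r) ≤ inner r x y
      c+1≤inner = begin
          suc (c r)                          ≡⟨ +-comm 1 (c r) ⟩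
          c r + 1                            ≤⟨ +-mono-≤ (≤-trans (≤-reflexive (sym c-neighbours))
                                                                  (count-mono (λ z e → ∧-intro (below⊆ball z e) (∧-elimʳ {adj y z} e))))
                                                        (count-witness _ w (∧-intro (∧-intro (adj-true y∼w) (within-true w-in-ball))
                                                                                     (not-intro w-not-below))) ⟩
          count (λ z → A z ∧ distIs G r₁ x z) + count (λ z → A z ∧ not (distIs G r₁ x z))
                                             ≡⟨ sym (count-split A (distIs G r₁ x)) ⟩
          inner r x y                        ∎
        where open ≤-Reasoning

    br-positive : r < D → 1 ≤ b r
    br-positive r<D = ≤-trans (count-witness _ (spine (suc r)) (∧-intro (adj-true (spine-adj r<D)) (dist-true (spine-dist r<D))))
                              (≤-reflexive (b-count xy))

    drop-data : DropData k D r l (Ball x r₁) (Layer x r₁) (Layer x r) (c r) (b r) (b r₁)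
    drop-data = record
      { D≥3                = D≥3
      ; l≥1                = l≥1
      ; l≤r                = l≤r
      ; ball-size          = subst (λ j → j * j ≤ Ball x r₁) r₁+1≡r (proj₁ (growth r₁ r₁<r))
      ; prev-size          = proj₂ (growth r₁ r₁<r)
      ; first-layer        = λ r≡1 → subst (λ j → k ≤ Layer x j) (sym r≡1) K₁≥k
      ; second-layer       = λ r≡2 → subst (λ j → k ≤ Layer x (j ∸ 1)) (sym r≡2) K₁≥k
      ; balance            = subst (λ j → Layer x j * c j ≡ Layer x r₁ * b r₁) r₁+1≡r (Layer-balance x r₁)
      ; bprev-large        = b-before r₁ r₁<r
      ; valency            = valency
      ; valency-same-layer = valency-same-layer
      ; br-positive        = br-positive
      }
      where
      K₁≥k : k ≤ Layer x 1
      K₁≥k = Layer-one (spine-dist (≤-trans (s≤s z≤n) D≥3))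

    S-small : 2 * count S ≤ n
    S-small = begin
        2 * count S                        ≤⟨ *-monoʳ-≤ 2 S-size ⟩
        2 * (r + 1 + l)                    ≤⟨ drop-count k≥3 drop-data ⟩
        Ball x r₁ + Layer x r + (D ∸ r)    ≡⟨ cong (_+ (D ∸ r)) ball-r ⟩
        Ball x r + (D ∸ r)                 ≤⟨ Ball-tail r (D ∸ r) (≤-reflexive (m+[n∸m]≡n r≤D)) ⟩
        Ball x (r + (D ∸ r))               ≤⟨ count-≤-size (within G (r + (D ∸ r)) x) ⟩
        n                                  ∎
      where
      open ≤-Reasoning
      ball-r : Ball x r₁ + Layer x r ≡ Ball x r
      ball-r = subst (λ j → Ball x r₁ + Layer x j ≡ Ball x j) r₁+1≡r (sym (Ball-suc x r₁))

    cheeger : CheegerAtMost G (k ∸ 2) k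
    cheeger = InnerDegreeBound.cheeger-bound G reg (P 0 , P-in-S 0 z≤n) S-small S-inner-degree

module LeastNumber {P : ℕ → Set} (P? : ∀ j → Dec (P j)) where

  Least : ℕ → Set
  Least m = ∃ λ r → r ≤ m × P r × (∀ j → j < r → ¬ P j)

  scan : ∀ m → Least m ⊎ (∀ j → j ≤ m → ¬ P j)
  scan zero with P? 0
  ... | yes p₀ = inj₁ (0 , z≤n , p₀ , λ _ ())
  ... | no ¬p₀ = inj₂ (λ { zero _ → ¬p₀ })
  scan (suc m) with scan m
  ... | inj₁ (r , r≤m , pr , below) = inj₁ (r , m≤n⇒m≤1+n r≤m , pr , below)
  ... | inj₂ none with P? (suc m)
  ...   | yes p = inj₁ (suc m , ≤-refl , p , λ j j<m+1 → none j (≤-pred j<m+1))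
  ...   | no ¬p = inj₂ none′
    where
    none′ : ∀ j → j ≤ suc m → ¬ P j
    none′ j j≤m+1 with j ≟ℕ suc m
    ... | yes refl = ¬p
    ... | no j≢m+1 = none j (≤-pred (≤∧≢⇒< j≤m+1 j≢m+1))

  least : ∀ {m} → P m → Least m
  least {m} pm with scan m
  ... | inj₁ found = found
  ... | inj₂ none = ⊥-elim (none m ≤-refl pm)

-- Since b_D = 0 ≤ k - 2, the first drop r ≤ D exists; the construction
-- there gives the set witnessing h_G ≤ (k-2)/k.
lemma6p2 : (n : ℕ) (G : Graph n) (k D : ℕ) →
    3 ≤ k → 3 ≤ D →
    Regular G k → ConnectedWithDiameter G D → DistanceRegular G →
    CheegerAtMost G (k ∸ 2) k
lemma6p2 n G k D k≥3 D≥3 reg (connected , x , u , xu) (b , c , array) =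
  from-first-drop (least b_D-small)
  where
  open Distances G using (dist✓)
  open Layers G reg array using (b-diameter; module FirstDrop)
  open LeastNumber (λ j → b j ≤? k ∸ 2) using (Least; least)
  b_D-small : b D ≤ k ∸ 2
  b_D-small = subst (_≤ k ∸ 2) (sym (b-diameter connected (dist✓ xu))) z≤n
  from-first-drop : Least D → CheegerAtMost G (k ∸ 2) k
  from-first-drop (r , r≤D , drop , before) = FirstDrop.cheeger k≥3 D≥3 (dist✓ xu) r≤D drop before
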